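{- Let $\mathbf B$ be a finite MTL-chain, $b\in B^+$, and let $C\subseteq W^c$ be a $P^c_b$-cluster of the canonical model of $\mathsf P_{\mathbf B}$. If $P^{c<}_b(v,w)$ holds for some $v,w\in C$, then $P^{c<}_b(s,t)$ holds for all $s,t\in C$.
   Context: A finite MTL-chain is a finite linearly ordered bounded integral commutative residuated lattice $\mathbf{B}$; $B^+=B\setminus\{0\}$. Language $\mathbf{PFm}$: propositional variables, truth constants $\overline c$ ($c\in B$), connectives $\wedge,\vee,\odot,\to$, modalities $\Box_c$ ($c\in B$) and $\Box^<_c$ ($c\in B^+$); $\varphi\leftrightarrow\psi:=(\varphi\to\psi)\odot(\psi\to\varphi)$, $\Diamond_c\varphi:=\bigwedge_{a\in B}(\Box_c(\varphi\to\overline a)\to\overline a)$. $\mathsf P_{\mathbf B}$ is the Hilbert system consisting of: a sound and complete axiomatization of the propositional logic of $\mathbf B$ with constants (instances in $\mathbf{PFm}$, with modus ponens); for each modality $\Box\in\{\Box_c:c\in B\}\cup\{\Box^<_c:c\in B^+\}$ the axioms $\Box\overline1$, $(\Box\varphi\wedge\Box\psi)\to\Box(\varphi\wedge\psi)$, $\Box(\overline a\to\varphi)\leftrightarrow(\overline a\to\Box\varphi)$ ($a\in B$), $\Box(\overline k\vee\varphi)\to(\overline k\vee\Box\varphi)$ ($k$ the coatom), $\Box(\varphi\to\psi)\to(\Box\varphi\to\Box\psi)$, monotonicity and necessitation rules; $\Box_a\varphi\to\Box_c\varphi$ ($a\le c$ in $B$); $\Box_a\varphi\to\varphi$; $\Box_{a\wedge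 c}\varphi\to\Box_a\Box_c\varphi$; $\varphi\to\Box_0\Diamond_0\varphi$; $\Box^<_a\varphi\to\Box^<_c\varphi$ ($a\le c$ in $B^+$); $\Box^<_{a\wedge c}\varphi\to\Box^<_a\Box^<_c\varphi$ ($a,c\in B^+$); $\Box_c\varphi\to\Box^<_c\varphi$ ($c\in B^+$); for $a,c\in B^+$, $c\le a$: $\Box^<_c\varphi\to\Box_a\Box^<_c\varphi$ and $\Box^<_c\varphi\to\Box^<_c\Box_a\varphi$; for $c\in B^+,a\in B$: $(\Box^<_c\varphi\wedge(\psi\to\overline a))\to\Box_c(\varphi\vee(\Box_c\psi\to\overline a))$. Canonical model: $W^c$ is the set of maps $v:\mathbf{PFm}\to B$ that are homomorphisms for the connectives with $v(\overline c)=c$ and send every theorem of $\mathsf P_{\mathbf B}$ to $1$; $P^c_c(v,w)$ iff for all $\varphi$, $v(\Box_c\varphi)=1$ implies $w(\varphi)=1$; $P^{c<}_c(v,w)$ iff for all $\varphi$, $v(\Box^<_c\varphi)=1$ implies $w(\varphi)=1$. A $P^c_b$-cluster is a maximal subset $C\subseteq W^c$ such that $P^c_b(v,w)$ and $P^c_b(w,v)$ hold for all $v,w\in C$. -}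

module Defs where

open import Level using (0ℓ)
open import Data.Nat using (ℕ)
open import Data.Product using (_×_; _,_)
open import Data.List using (List; []; _∷_; foldr)
open import Data.List.Membership.Propositional using (_∈_)
open import Data.Empty using (⊥)
open import Relation.Nullary using (¬_; yes; no)
open import Relation.Binary.Core using (Rel)
open import Relation.Binary.Definitions using (Decidable)
open import Relation.Binary.Structures using (IsTotalOrder)
open import Relation.Binary.PropositionalEquality using (_≡_; _≢_; refl)
open import Relation.Unary using (Pred; _⊆_)
open import Algebra.Structures using (IsCommutativeMonoid)
open import Function.Bundles using (_⇔_)

record FiniteMTLChain : Set₁ where
  field
    Carrier        : Set
    _≤_            : Rel Carrier 0ℓ
    isTotalOrder   : IsTotalOrder _≡_ _≤_
    _≤?_           : Decidable _≤_
    𝟘 𝟙            : Carrier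
    𝟘-least        : ∀ a → 𝟘 ≤ a
    𝟙-greatest     : ∀ a → a ≤ 𝟙
    _⊙_            : Carrier → Carrier → Carrier
    _⇨_            : Carrier → Carrier → Carrier
    ⊙-isCommMonoid : IsCommutativeMonoid _≡_ _⊙_ 𝟙
    ⊙-monoˡ        : ∀ {a b} c → a ≤ b → (a ⊙ c) ≤ (b ⊙ c)
    residuation    : ∀ a b c → ((a ⊙ b) ≤ c) ⇔ (a ≤ (b ⇨ c))
    enum           : List Carrier
    enum-complete  : ∀ a → a ∈ enum

  _⊓_ : Carrier → Carrier → Carrier
  a ⊓ c with a ≤? c
  ... | yes _ = a
  ... | no  _ = c

  _⊔_ : Carrier → Carrier → Carrier
  a ⊔ c with a ≤? c
  ... | yes _ = c
  ... | no  _ = a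

  _<_ : Rel Carrier 0ℓ
  a < c = (a ≤ c) × (a ≢ c)

  IsCoatom : Carrier → Set
  IsCoatom k = (k < 𝟙) × (∀ x → x < 𝟙 → x ≤ k)

  ⊓-pos : ∀ {a c} → a ≢ 𝟘 → c ≢ 𝟘 → (a ⊓ c) ≢ 𝟘
  ⊓-pos {a} {c} pa pc with a ≤? c
  ... | yes _ = pa
  ... | no  _ = pc

module Logic (𝐁 : FiniteMTLChain) where
  open FiniteMTLChain 𝐁 public

  -- modalities: □_c (c ∈ B) and □^<_c (c ∈ B⁺)
  data Mod : Set where
    □ : Carrier → Mod
    □< : (c : Carrier) → .(c ≢ 𝟘) → Mod

  infixr 30 _⊙f_
  infixr 25 _∧f_ _∨f_
  infixr 20 _→f_
  infixr 20 _↔f_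
  infix 40 ‵_

  data Fm : Set where
    var   : ℕ → Fm
    ‵_    : Carrier → Fm
    _∧f_ _∨f_ _⊙f_ _→f_ : Fm → Fm → Fm
    box   : Mod → Fm → Fm

  _↔f_ : Fm → Fm → Fm
  φ ↔f ψ = (φ →f ψ) ⊙f (ψ →f φ)

  ◇ : Carrier → Fm → Fm
  ◇ c φ = foldr (λ a acc → (box (□ c) (φ →f ‵ a) →f ‵ a) ∧f acc) (‵ 𝟙) enum

  -- evaluation in B, treating variables and modal formulas as atoms
  eval : (ℕ → Carrier) → (Mod → Fm → Carrier) → Fm → Carrier
  eval ρ μ (var n)   = ρ n
  eval ρ μ (‵ c)     = c
  eval ρ μ (φ ∧f ψ)  = eval ρ μ φ ⊓ eval ρ μ ψ
  eval ρ μ (φ ∨f ψ)  = eval ρ μ φ ⊔ eval ρ μ ψ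
  eval ρ μ (φ ⊙f ψ)  = eval ρ μ φ ⊙ eval ρ μ ψ
  eval ρ μ (φ →f ψ)  = eval ρ μ φ ⇨ eval ρ μ ψ
  eval ρ μ (box m φ) = μ m φ

  -- PFm-instances of tautologies of the propositional logic of B with
  -- constants (= the theorems of any sound and complete axiomatization)
  Taut : Fm → Set
  Taut φ = ∀ ρ μ → eval ρ μ φ ≡ 𝟙

  data Thm : Fm → Set where
    taut  : ∀ {φ} → Taut φ → Thm φ
    mp    : ∀ {φ ψ} → Thm φ → Thm (φ →f ψ) → Thm ψ
    ax-1  : ∀ m → Thm (box m (‵ 𝟙))
    ax-∧  : ∀ m φ ψ → Thm ((box m φ ∧f box m ψ) →f box m (φ ∧f ψ))
    ax-c  : ∀ m a φ → Thm (box m (‵ a →f φ) ↔f (‵ a →f box m φ))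
    ax-k  : ∀ m k φ → IsCoatom k → Thm (box m (‵ k ∨f φ) →f (‵ k ∨f box m φ))
    ax-K  : ∀ m φ ψ → Thm (box m (φ →f ψ) →f (box m φ →f box m ψ))
    mono  : ∀ m {φ ψ} → Thm (φ →f ψ) → Thm (box m φ →f box m ψ)
    nec   : ∀ m {φ} → Thm φ → Thm (box m φ)
    ax1 : ∀ a c φ → a ≤ c → Thm (box (□ a) φ →f box (□ c) φ)
    ax2 : ∀ a φ → Thm (box (□ a) φ →f φ)
    ax3 : ∀ a c φ → Thm (box (□ (a ⊓ c)) φ →f box (□ a) (box (□ c) φ))
    ax4 : ∀ φ → Thm (φ →f box (□ 𝟘) (◇ 𝟘 φ))
    ax5 : ∀ a c (pa : a ≢ 𝟘) (pc : c ≢ 𝟘) φ → a ≤ c →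
          Thm (box (□< a pa) φ →f box (□< c pc) φ)
    ax6 : ∀ a c (pa : a ≢ 𝟘) (pc : c ≢ 𝟘) φ →
          Thm (box (□< (a ⊓ c) (⊓-pos pa pc)) φ →f box (□< a pa) (box (□< c pc) φ))
    ax7 : ∀ c (pc : c ≢ 𝟘) φ → Thm (box (□ c) φ →f box (□< c pc) φ)
    ax8 : ∀ a c (pa : a ≢ 𝟘) (pc : c ≢ 𝟘) φ → c ≤ a →
          Thm (box (□< c pc) φ →f box (□ a) (box (□< c pc) φ))
    ax9 : ∀ a c (pa : a ≢ 𝟘) (pc : c ≢ 𝟘) φ → c ≤ a →
          Thm (box (□< c pc) φ →f box (□< c pc) (box (□ a) φ))
    ax10 : ∀ c (pc : c ≢ 𝟘) a φ ψ →
           Thm ((box (□< c pc) φ ∧f (ψ →f ‵ a)) →f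
                box (□ c) (φ ∨f (box (□ c) ψ →f ‵ a)))

  record World : Set where
    field
      val   : Fm → Carrier
      v-con : ∀ c → val (‵ c) ≡ c
      v-∧   : ∀ φ ψ → val (φ ∧f ψ) ≡ val φ ⊓ val ψ
      v-∨   : ∀ φ ψ → val (φ ∨f ψ) ≡ val φ ⊔ val ψ
      v-⊙   : ∀ φ ψ → val (φ ⊙f ψ) ≡ val φ ⊙ val ψ
      v-→   : ∀ φ ψ → val (φ →f ψ) ≡ val φ ⇨ val ψ
      v-thm : ∀ φ → Thm φ → val φ ≡ 𝟙
  open World public

  -- canonical accessibility relation of a modality:
  -- R m v w  iff  ∀ φ, v(m φ) = 1 ⇒ w(φ) = 1
  -- (R (□ c) is P^c_c, R (□< c p) is P^{c<}_c)
  R : Mod → World → World → Set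
  R m v w = ∀ φ → val v (box m φ) ≡ 𝟙 → val w φ ≡ 𝟙

  MutuallyRelated : Mod → Pred World 0ℓ → Set
  MutuallyRelated m C = ∀ v w → C v → C w → R m v w × R m w v

  IsCluster : Mod → Pred World 0ℓ → Set₁
  IsCluster m C = MutuallyRelated m C ×
                  (∀ (D : Pred World 0ℓ) → C ⊆ D → MutuallyRelated m D → D ⊆ C)

-- The argument reads the interaction axioms 8 and 9 of P_B as properties
-- of the canonical relations.  Throughout, c ≤ a with c, a ∈ B⁺.
--   * Axiom 8, □<_c φ → □_a □<_c φ, says that truth (value 1) of □<_c φ
--     is preserved along P^c_a.
--   * Axiom 9, □<_c φ → □<_c □_a φ, says that a P^{c<}_c-step followed by
--     a P^c_a-step is again a P^{c<}_c-step.
-- Together they give the sandwich property: P^c_a ; P^{c<}_c ; P^c_a is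
-- contained in P^{c<}_c.  For the theorem take a = c = b: if v, w ∈ C are
-- P^{c<}_b-related and s, t ∈ C, then P^c_b(s,v) and P^c_b(w,t) hold
-- because C is a P^c_b-cluster, so the sandwich yields P^{c<}_b(s,t).
-- The only facts about worlds needed are that they are closed under
-- provable implications, which rests on 1 ⇨ x = 1 ⇒ x = 1 in B.
module Submission where

open import Defs
open import Level using (0ℓ)
open import Data.Product using (Σ; _×_; _,_; proj₁)
open import Relation.Binary.PropositionalEquality
  using (_≢_; _≡_; sym; cong; subst; module ≡-Reasoning)
open import Relation.Unary using (Pred)
open import Relation.Binary.Structures using (IsTotalOrder; IsPartialOrder)
open import Algebra.Structures using (IsCommutativeMonoid)
open import Function.Bundles using (Equivalence)

module _ (𝐁 : FiniteMTLChain) where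
  open Logic 𝐁

  private
    module ≤ = IsPartialOrder (IsTotalOrder.isPartialOrder isTotalOrder)

  -- In an integral residuated chain, 1 → x takes the value 1 only for x = 1:
  -- residuation turns 1 ≤ 1 ⇨ x into 1 ⊙ 1 ≤ x, i.e. 1 ≤ x.
  ⇨-from-𝟙 : ∀ x → (𝟙 ⇨ x) ≡ 𝟙 → x ≡ 𝟙
  ⇨-from-𝟙 x 𝟙⇨x≡𝟙 = ≤.antisym (𝟙-greatest x) 𝟙≤x
    where
    𝟙≤𝟙⇨x : 𝟙 ≤ (𝟙 ⇨ x)
    𝟙≤𝟙⇨x = subst (𝟙 ≤_) (sym 𝟙⇨x≡𝟙) (𝟙-greatest 𝟙)

    𝟙≤x : 𝟙 ≤ x
    𝟙≤x = subst (_≤ x) (IsCommutativeMonoid.identityˡ ⊙-isCommMonoid 𝟙)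
                (Equivalence.from (residuation 𝟙 𝟙 x) 𝟙≤𝟙⇨x)

  world-mp : (u : World) {φ ψ : Fm} → Thm (φ →f ψ) → val u φ ≡ 𝟙 → val u ψ ≡ 𝟙
  world-mp u {φ} {ψ} ⊢φ→ψ uφ≡𝟙 = ⇨-from-𝟙 (val u ψ) 𝟙⇨uψ≡𝟙
    where
    open ≡-Reasoning
    𝟙⇨uψ≡𝟙 : (𝟙 ⇨ val u ψ) ≡ 𝟙
    𝟙⇨uψ≡𝟙 = begin
      𝟙 ⇨ val u ψ          ≡⟨ cong (_⇨ val u ψ) (sym uφ≡𝟙) ⟩
      val u φ ⇨ val u ψ    ≡⟨ sym (v-→ u φ ψ) ⟩
      val u (φ →f ψ)       ≡⟨ v-thm u _ ⊢φ→ψ ⟩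
      𝟙                    ∎

  □<-persists : ∀ a c (pa : a ≢ 𝟘) (pc : c ≢ 𝟘) → c ≤ a →
                ∀ {s v} → R (□ a) s v →
                ∀ φ → val s (box (□< c pc) φ) ≡ 𝟙 → val v (box (□< c pc) φ) ≡ 𝟙
  □<-persists a c pa pc c≤a {s} Rsv φ s⊨□<φ =
    Rsv (box (□< c pc) φ) (world-mp s (ax8 a c pa pc φ c≤a) s⊨□<φ)

  R<-then-R : ∀ a c (pa : a ≢ 𝟘) (pc : c ≢ 𝟘) → c ≤ a →
              ∀ {v w t} → R (□< c pc) v w → R (□ a) w t → R (□< c pc) v t
  R<-then-R a c pa pc c≤a {v} Rvw Rwt φ v⊨□<φ =
    Rwt φ (Rvw (box (□ a) φ) (world-mp v (ax9 a c pa pc φ c≤a) v⊨□<φ))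

  R<-sandwich : ∀ a c (pa : a ≢ 𝟘) (pc : c ≢ 𝟘) → c ≤ a →
                ∀ {s v w t} → R (□ a) s v → R (□< c pc) v w → R (□ a) w t →
                R (□< c pc) s t
  R<-sandwich a c pa pc c≤a {s} {v} {w} {t} Rsv Rvw Rwt φ s⊨□<φ =
    R<-then-R a c pa pc c≤a {v} {w} {t} Rvw Rwt φ
              (□<-persists a c pa pc c≤a {s} {v} Rsv φ s⊨□<φ)

lemma6 : (𝐁 : FiniteMTLChain) → let open Logic 𝐁 in
    (b : Carrier) (pb : b ≢ 𝟘) (C : Pred World 0ℓ) → IsCluster (□ b) C →
    Σ World (λ v → Σ World (λ w → C v × C w × R (□< b pb) v w)) →
    ∀ s t → C s → C t → R (□< b pb) s t
lemma6 𝐁 b pb C (related , _) (v , w , Cv , Cw , Rvw) s t Cs Ct =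
  R<-sandwich 𝐁 b b pb pb b≤b {s} {v} {w} {t}
    (proj₁ (related s v Cs Cv)) Rvw (proj₁ (related w t Cw Ct))
  where
  open Logic 𝐁
  b≤b : b ≤ b
  b≤b = IsPartialOrder.refl (IsTotalOrder.isPartialOrder isTotalOrder)
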